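{- Let $\mathcal M=(W,W^\bot,\preccurlyeq,\sqsubseteq,V)$ be a bi-intuitionistic model, $\Sigma$ a set of formulas, and $\approx$ a strong $\Sigma$-bisimulation on $\mathcal M$ that is also an equivalence relation. If $\mathcal M$ is forth--down confluent, then so is $\mathcal M/\!\approx$.
   Context: Language $\mathcal L$ over countably many propositional variables $\mathbb P$: $\varphi ::= p \mid \bot \mid \varphi\wedge\varphi\mid\varphi\vee\varphi\mid\varphi\to\varphi\mid\Diamond\varphi\mid\Box\varphi$. A bi-intuitionistic model $(W,W^\bot,\preccurlyeq,\sqsubseteq,V)$: $\preccurlyeq,\sqsubseteq$ preorders on $W$, $W^\bot\subseteq W$ closed upward under both, $V:\mathbb P\to2^W$ with each $V(p)$ $\preccurlyeq$-upward closed and containing $W^\bot$. Satisfaction: $w\models p$ iff $w\in V(p)$; $w\models\bot$ iff $w\in W^\bot$; $\wedge,\vee$ pointwise; $w\models\varphi\to\psi$ iff for all $v\succcurlyeq w$, $v\models\varphi$ implies $v\models\psi$; $w\models\Diamond\varphi$ iff for all $u\succcurlyeq w$ there is $v\sqsupseteq u$ with $v\models\varphi$; $w\models\Box\varphi$ iff for all $u,v$ with $w\preccurlyeq u\sqsubseteq v$, $v\models\varphi$. For a relation $R$ on $W$: forth--up confluent if $w\preccurlyeq w'$, $w\mathrel R v$ imply some $v'$ with $v\preccurlyeq v'$, $w'\mathrel R v'$; back--up confluent if $w\mathrel R v\preccurlyeq v'$ implies some $w'$ with $w\preccurlyeq w'\mathrel R v'$; forth--down confluent if $w\preccurlyeq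 v\mathrel R v'$ implies some $w'$ with $w\mathrel R w'\preccurlyeq v'$. A model is forth--down confluent if $\sqsubseteq$ is. The $\Sigma$-label of $w$ is $\ell(w)=(\ell^+(w),\ell^\Diamond(w))$, $\ell^+(w)=\{\varphi\in\Sigma:w\models\varphi\}$, $\ell^\Diamond(w)=\{\varphi\in\Sigma:\forall v\,(w\sqsubseteq v\Rightarrow v\not\models\varphi)\}$. A $\Sigma$-bisimulation is a forth--up and back--up confluent $Z$ with $w\mathrel Zv\Rightarrow\ell(w)=\ell(v)$; it is strong if both $Z$ and $Z^{ -1}$ are forth--down confluent. Quotient: for an equivalence relation $\approx$ with classes $[w]$, $\mathcal M/\!\approx$ has worlds $W/\!\approx$, fallible worlds $\{[w]:w\in W^\bot\}$, $[w]\preccurlyeq'[v]$ iff some $w'\approx w$, $v'\approx v$ have $w'\preccurlyeq v'$, $\sqsubseteq'$ the transitive closure of the relation "some $w'\approx w$, $v'\approx v$ have $w'\sqsubseteq v'$", and valuation $p\mapsto\{[w]:w\in V(p)\}$; it is forth--down confluent if $\sqsubseteq'$ is forth--down confluent with respect to $\preccurlyeq'$. -}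

module Defs where

open import Level using (0ℓ)
open import Data.Nat using (ℕ)
open import Data.Product using (Σ; ∃; _×_; _,_)
open import Data.Sum using (_⊎_)
open import Relation.Nullary using (¬_)
open import Relation.Binary using (Rel; IsPreorder; IsEquivalence)
open import Relation.Binary.Construct.Closure.Transitive using (TransClosure)
open import Function.Bundles using (_⇔_)
open import Relation.Binary.PropositionalEquality using (_≡_)

data Formula : Set where
  var  : ℕ → Formula
  ⊥'   : Formula
  _∧'_ : Formula → Formula → Formula
  _∨'_ : Formula → Formula → Formula
  _⇒'_ : Formula → Formula → Formula
  ◇'   : Formula → Formula
  □'   : Formula → Formula

record Model : Set₁ where
  field
    W      : Set
    Wbot   : W → Set
    _≼_    : Rel W 0ℓ
    _⊑_    : Rel W 0ℓ
    ≼-pre  : IsPreorder _≡_ _≼_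
    ⊑-pre  : IsPreorder _≡_ _⊑_
    Wbot-≼ : ∀ {w v} → w ≼ v → Wbot w → Wbot v
    Wbot-⊑ : ∀ {w v} → w ⊑ v → Wbot w → Wbot v
    V      : ℕ → W → Set
    V-≼    : ∀ p {w v} → w ≼ v → V p w → V p v
    V-bot  : ∀ p {w} → Wbot w → V p w

module _ (M : Model) where
  open Model M

  _⊨_ : W → Formula → Set
  w ⊨ var p   = V p w
  w ⊨ ⊥'      = Wbot w
  w ⊨ (φ ∧' ψ) = (w ⊨ φ) × (w ⊨ ψ)
  w ⊨ (φ ∨' ψ) = (w ⊨ φ) ⊎ (w ⊨ ψ)
  w ⊨ (φ ⇒' ψ) = ∀ v → w ≼ v → v ⊨ φ → v ⊨ ψ
  w ⊨ ◇' φ    = ∀ u → w ≼ u → Σ W λ v → u ⊑ v × v ⊨ φ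
  w ⊨ □' φ    = ∀ u v → w ≼ u → u ⊑ v → v ⊨ φ

  ℓ⁺-mem : (Formula → Set) → W → Formula → Set
  ℓ⁺-mem Sig w φ = Sig φ × w ⊨ φ

  ℓ◇-mem : (Formula → Set) → W → Formula → Set
  ℓ◇-mem Sig w φ = Sig φ × (∀ v → w ⊑ v → ¬ (v ⊨ φ))

  SameLabel : (Formula → Set) → W → W → Set
  SameLabel Sig w v = ∀ φ → (ℓ⁺-mem Sig w φ ⇔ ℓ⁺-mem Sig v φ)
                          × (ℓ◇-mem Sig w φ ⇔ ℓ◇-mem Sig v φ)

module _ {W : Set} (_≼_ : Rel W 0ℓ) where
  ForthUp : Rel W 0ℓ → Set
  ForthUp R = ∀ {w w' v} → w ≼ w' → R w v → Σ W λ v' → v ≼ v' × R w' v'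

  BackUp : Rel W 0ℓ → Set
  BackUp R = ∀ {w v v'} → R w v → v ≼ v' → Σ W λ w' → w ≼ w' × R w' v'

  ForthDown : Rel W 0ℓ → Set
  ForthDown R = ∀ {w v v'} → w ≼ v → R v v' → Σ W λ w' → R w w' × w' ≼ v'

Converse : {W : Set} → Rel W 0ℓ → Rel W 0ℓ
Converse R x y = R y x

ModelForthDown : Model → Set
ModelForthDown M = ForthDown _≼_ _⊑_ where open Model M

record StrongBisim (M : Model) (Sig : Formula → Set) (Z : Rel (Model.W M) 0ℓ) : Set where
  open Model M
  field
    forthUp   : ForthUp _≼_ Z
    backUp    : BackUp _≼_ Z
    labels    : ∀ {w v} → Z w v → SameLabel M Sig w v
    forthDown : ForthDown _≼_ Z
    forthDown⁻¹ : ForthDown _≼_ (Converse Z)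

-- Quotient relations, represented on representatives: [w] ≼' [v] and
-- the pre-closure of ⊑' (its transitive closure is ⊑').
module Quotient (M : Model) (_≈_ : Rel (Model.W M) 0ℓ) where
  open Model M

  _≼q_ : Rel W 0ℓ
  w ≼q v = Σ W λ w' → Σ W λ v' → w' ≈ w × v' ≈ v × w' ≼ v'

  _⊑q₀_ : Rel W 0ℓ
  w ⊑q₀ v = Σ W λ w' → Σ W λ v' → w' ≈ w × v' ≈ v × w' ⊑ v'

  _⊑q_ : Rel W 0ℓ
  _⊑q_ = TransClosure _⊑q₀_

  QuotientForthDown : Set
  QuotientForthDown = ForthDown _≼q_ _⊑q_

-- A step [w] ≼' [v] ⊑' [v'] is lifted to representatives w₀ ≼ v₀ ≈ v₁ ⊑ v₁'.
-- Forth–down confluence of ≈ moves w₀ to some w₁ ≈ w₀ with w₁ ≼ v₁, and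
-- forth–down confluence of ⊑ then gives w₁ ⊑ w' ≼ v₁', so [w] ⊑' [w'] ≼' [v'].
-- Forth–down confluence is preserved by transitive closure, which handles ⊑'.
module Submission where

open import Defs
open import Level using (0ℓ)
open import Relation.Binary using (Rel; IsEquivalence)
open import Data.Product using (Σ; _,_)
open import Relation.Binary.Construct.Closure.Transitive using (TransClosure; [_]; _∷_; _++_)

forthDown-transClosure : {W : Set} {_≼_ R : Rel W 0ℓ}
  → ForthDown _≼_ R → ForthDown _≼_ (TransClosure R)
forthDown-transClosure fd w≼v [ vRv' ] with fd w≼v vRv'
... | w' , wRw' , w'≼v' = w' , [ wRw' ] , w'≼v'
forthDown-transClosure fd w≼v (vRu ∷ uR⁺v') with fd w≼v vRu
... | w₁ , wRw₁ , w₁≼u with forthDown-transClosure fd w₁≼u uR⁺v'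
... | w' , w₁R⁺w' , w'≼v' = w' , wRw₁ ∷ w₁R⁺w' , w'≼v'

module _ (M : Model) {_≈_ : Rel (Model.W M) 0ℓ} (≈-equiv : IsEquivalence _≈_) where
  open Model M
  open Quotient M _≈_
  open IsEquivalence ≈-equiv

  quotient-forthDown-step : ForthDown _≼_ _≈_ → ModelForthDown M → ForthDown _≼q_ _⊑q₀_
  quotient-forthDown-step ≈-fd ⊑-fd
    (w₀ , v₀ , w₀≈w , v₀≈v , w₀≼v₀) (v₁ , v₁' , v₁≈v , v₁'≈v' , v₁⊑v₁')
    with ≈-fd w₀≼v₀ (trans v₀≈v (sym v₁≈v))
  ... | w₁ , w₀≈w₁ , w₁≼v₁ with ⊑-fd w₁≼v₁ v₁⊑v₁'
  ... | w' , w₁⊑w' , w'≼v₁' =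
    w' , (w₁ , w' , trans (sym w₀≈w₁) w₀≈w , refl , w₁⊑w') , (w' , v₁' , refl , v₁'≈v' , w'≼v₁')

mainTheorem14 : (M : Model) (Sig : Formula → Set) (_≈_ : Rel (Model.W M) 0ℓ)
                → IsEquivalence _≈_ → StrongBisim M Sig _≈_
                → ModelForthDown M → Quotient.QuotientForthDown M _≈_
mainTheorem14 M Sig _≈_ ≈-equiv bisim ⊑-fd =
  forthDown-transClosure (quotient-forthDown-step M ≈-equiv (StrongBisim.forthDown bisim) ⊑-fd)
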